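{- Let $r$ be a positive integer and $n\in F_r$. Then \[R(n)<\frac{J_r}{r}Q_1(n)\,(Q_1(n)-r).\]
   Context: For a positive integer $r$, $S_r$ is the multiplicative function with $S_r(q^\alpha)=0$ if $q\le r$ and $S_r(q^\alpha)=q^{\alpha-1}(q-r)$ if $q>r$. $B_r=\{n\in\mathbb{N}: S_r(n)>0\}$. $F_r$ is the set of $n\in B_r$ with $S_r(n)<S_r(m)$ for all $m\in B_r$, $m>n$. $R(n)=n\prod_{p \text{ prime},\,p\mid n}p^{ -1}$. $Q_1(n)$ is the smallest prime that is larger than $r$ and does not divide $n$. $r\#$ is the product of all primes $\le r$ (with $1\#=1$); the Jacobsthal function $J(N)$ is the smallest positive integer $a$ such that every set of $a$ consecutive integers contains an element coprime to $N$; $J_r=J(r\#)$. -}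

module Defs where

open import Data.Nat using (ℕ; zero; suc; _+_; _*_; _∸_; _≤_; _<_)
open import Data.Nat.Divisibility using (_∣_; _∣?_)
open import Data.Nat.Primality using (Prime; prime?)
open import Data.Nat.Coprimality using (Coprime)
open import Data.Nat.DivMod using (_/_)
open import Data.Integer as ℤ using (ℤ; ∣_∣)
open import Data.List using (List; filter; upTo)
open import Data.Nat.ListAction using (product)
open import Data.Product using (_×_)
open import Relation.Nullary using (¬_)
open import Relation.Nullary.Decidable using (_×-dec_)

-- the list of prime divisors of n (for n ≥ 1; empty for n = 0)
primeDivisors : ℕ → List ℕ
primeDivisors n = filter (λ p → prime? p ×-dec p ∣? n) (upTo (suc n))

rad : ℕ → ℕ
rad n = product (primeDivisors n)

-- R(n) = n ∏_{p | n} p⁻¹   (rad n is never 0; the zero branch is unreachable)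
R : ℕ → ℕ
R n with rad n
... | zero  = 0
... | suc k = n / suc k

-- S_r(n) for n ≥ 1: the multiplicative function with
-- S_r(q^α) = q^(α-1) (q - r) if q > r and 0 if q ≤ r.
-- Unfolded: S_r(n) = ∏_{q^α ∥ n} q^(α-1) (q ∸ r) = R(n) · ∏_{q | n} (q ∸ r),
-- where truncated subtraction gives exactly the factor 0 when q ≤ r.
S : ℕ → ℕ → ℕ
S r n = R n * product (Data.List.map (λ q → q ∸ r) (primeDivisors n))

InB : ℕ → ℕ → Set
InB r n = 1 ≤ n × 0 < S r n

InF : ℕ → ℕ → Set
InF r n = InB r n × ((m : ℕ) → InB r m → n < m → S r n < S r m)

IsQ1 : ℕ → ℕ → ℕ → Set
IsQ1 r n q = (Prime q × r < q × ¬ (q ∣ n))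
           × ((p : ℕ) → Prime p → r < p → ¬ (p ∣ n) → q ≤ p)

primorial : ℕ → ℕ
primorial r = product (filter prime? (upTo (suc r)))

ConsecutiveProperty : ℕ → ℕ → Set
ConsecutiveProperty N a =
  (k : ℤ) → Data.Product.∃ λ i → i < a × Coprime ∣ k ℤ.+ ℤ.+ i ∣ N

IsJacobsthal : ℕ → ℕ → Set
IsJacobsthal N a = 1 ≤ a × ConsecutiveProperty N a
                 × ((b : ℕ) → 1 ≤ b → ConsecutiveProperty N b → a ≤ b)

{-# OPTIONS --safe #-}
module Submission where

-- Suppose J·q(q − r) ≤ r·R(n). The Jacobsthal property yields k coprime to r# with
-- R(n)/q < k ≤ R(n)/q + J, so that kq > R(n) and, by the assumption, k(q − r) ≤ R(n).
-- Put m = k·q·rad(n). Then m > n, every prime factor of m exceeds r (so m ∈ B_r), and the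
-- prime factors of m include q and those of n, whence
--   S_r(m) = m ∏_{p∣m} (1 − r/p) ≤ k q rad(n) (1 − r/q) ∏_{p∣n} (1 − r/p) = k(q − r) S_r(n)/R(n) ≤ S_r(n),
-- contradicting n ∈ F_r.

open import Defs
open import Data.Bool using (if_then_else_; true; false)
open import Data.Integer using (+_)
open import Data.List using (List; []; _∷_; [_]; _++_; filter; map; upTo)
open import Data.List.Membership.Propositional using (_∈_)
open import Data.List.Membership.Propositional.Properties
  using (∈-filter⁺; ∈-filter⁻; ∈-upTo⁺; ∈-upTo⁻; ∈-map⁺)
open import Data.List.Properties
  using (upTo-∷ʳ; filter-++; filter-accept; filter-reject; ++-identityʳ; map-id)
open import Data.List.Relation.Unary.All as All using (All)
open import Data.List.Relation.Unary.All.Properties using (map⁺)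
open import Data.List.Relation.Unary.Any using (here; there)
open import Data.Nat.Base
open import Data.Nat.Properties
open import Data.Nat.Coprimality as Coprime using (Coprime; coprime⇒gcd≡1)
open import Data.Nat.Divisibility
open import Data.Nat.DivMod using (_/_; _%_; m≡m%n+[m/n]*n; m%n<n; m/n*n≤m; m/n*n≡m)
open import Data.Nat.GCD using (gcd)
open import Data.Nat.LCM using (lcm; lcm-least; gcd*lcm)
open import Data.Nat.ListAction using (product)
open import Data.Nat.ListAction.Properties using (product-++; ∈⇒∣product; product≢0)
open import Data.Nat.Primality
  using (Prime; prime?; ¬prime[1]; euclidsLemma; prime⇒irreducible; prime⇒nonZero; productOfPrimes≥1)
open import Data.Nat.Primality.Factorisation using (factorisationHasAllPrimeFactors)
open import Data.Nat.Tactic.RingSolver using (solve-∀)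
open import Algebra.Properties.CommutativeSemigroup *-commutativeSemigroup using (xy∙z≈xz∙y; x∙yz≈xz∙y)
open import Data.Product using (_×_; _,_; proj₁; proj₂; ∃)
open import Function using (id; _∘′_)
open import Data.Sum using (inj₁; inj₂)
open import Level using (0ℓ)
open import Relation.Binary.PropositionalEquality
  using (_≡_; refl; sym; trans; cong; cong₂; subst; subst₂; module ≡-Reasoning)
open import Relation.Nullary using (¬_; does; yes; no; contradiction)
open import Relation.Nullary.Decidable using (_×-dec_)
open import Relation.Unary using (Pred; Decidable; _⊆_)

prime∣prime⇒≡ : ∀ {p q} → Prime p → Prime q → p ∣ q → p ≡ q
prime∣prime⇒≡ pp pq p∣q with prime⇒irreducible pq p∣q
... | inj₁ refl = contradiction pp ¬prime[1]
... | inj₂ p≡q  = p≡q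

coprime-∣⇒*∣ : ∀ {a b n} → Coprime a b → a ∣ n → b ∣ n → a * b ∣ n
coprime-∣⇒*∣ {a} {b} coprime a∣n b∣n = subst (_∣ _) lcm≡a*b (lcm-least a∣n b∣n)
  where
  open ≡-Reasoning
  lcm≡a*b : lcm a b ≡ a * b
  lcm≡a*b = begin
    lcm a b           ≡⟨ *-identityˡ (lcm a b) ⟨
    1 * lcm a b       ≡⟨ cong (_* lcm a b) (coprime⇒gcd≡1 coprime) ⟨
    gcd a b * lcm a b ≡⟨ gcd*lcm a b ⟩
    a * b             ∎

m<[1+m/n]*n : ∀ m n .{{_ : NonZero n}} → m < suc (m / n) * n
m<[1+m/n]*n m n = begin-strict
  m                 ≡⟨ m≡m%n+[m/n]*n m n ⟩
  m % n + m / n * n <⟨ +-monoˡ-< (m / n * n) (m%n<n m n) ⟩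
  n + m / n * n     ∎
  where open ≤-Reasoning

k*[q∸r]≤x : ∀ {a k x q r J} .{{_ : NonZero q}} → r ≤ q → a * q ≤ x → k ≤ a + J →
  J * (q * (q ∸ r)) ≤ r * x → k * (q ∸ r) ≤ x
k*[q∸r]≤x {a} {k} {x} {q} {r} {J} r≤q aq≤x k≤a+J Jq[q∸r]≤rx = *-cancelˡ-≤ q (begin
  q * (k * (q ∸ r))                     ≤⟨ *-monoʳ-≤ q (*-monoˡ-≤ (q ∸ r) k≤a+J) ⟩
  q * ((a + J) * (q ∸ r))               ≡⟨ expand a J q (q ∸ r) ⟩
  a * q * (q ∸ r) + J * (q * (q ∸ r))   ≤⟨ +-mono-≤ (*-monoˡ-≤ (q ∸ r) aq≤x) Jq[q∸r]≤rx ⟩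
  x * (q ∸ r) + r * x                   ≡⟨ collect x (q ∸ r) r ⟩
  (q ∸ r + r) * x                       ≡⟨ cong (_* x) (m∸n+n≡m r≤q) ⟩
  q * x                                 ∎)
  where
  open ≤-Reasoning
  expand : ∀ a J q s → q * ((a + J) * s) ≡ a * q * s + J * (q * s)
  expand = solve-∀
  collect : ∀ x s r → x * s + r * x ≡ (s + r) * x
  collect = solve-∀

restrict : {P : Pred ℕ 0ℓ} → Decidable P → (ℕ → ℕ) → ℕ → ℕ
restrict P? f x = if does (P? x) then f x else 1

∏-map-filter : ∀ {P : Pred ℕ 0ℓ} (P? : Decidable P) f xs →
  product (map f (filter P? xs)) ≡ product (map (restrict P? f) xs)
∏-map-filter P? f []       = refl
∏-map-filter P? f (x ∷ xs) with does (P? x)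
... | true  = cong (f x *_) (∏-map-filter P? f xs)
... | false = trans (∏-map-filter P? f xs) (sym (*-identityˡ _))

∏-map-* : ∀ (f g : ℕ → ℕ) xs → product (map (λ x → f x * g x) xs) ≡ product (map f xs) * product (map g xs)
∏-map-* f g []       = refl
∏-map-* f g (x ∷ xs) =
  trans (cong (f x * g x *_) (∏-map-* f g xs)) ([m*n]*[o*p]≡[m*o]*[n*p] (f x) (g x) _ _)

∏-map-mono : ∀ {u v : ℕ → ℕ} xs → (∀ x → u x ≤ v x) → product (map u xs) ≤ product (map v xs)
∏-map-mono []       u≤v = ≤-refl
∏-map-mono (x ∷ xs) u≤v = *-mono-≤ (u≤v x) (∏-map-mono xs u≤v)

∏-map-mono-pivot : ∀ {u v : ℕ → ℕ} {x₀ c d} xs → x₀ ∈ xs → (∀ x → u x ≤ v x) →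
  u x₀ * c ≤ v x₀ * d → product (map u xs) * c ≤ product (map v xs) * d
∏-map-mono-pivot {u} {v} {c = c} {d} (x ∷ xs) (here refl) u≤v pivot = begin
  u x * product (map u xs) * c ≡⟨ xy∙z≈xz∙y (u x) _ c ⟩
  u x * c * product (map u xs) ≤⟨ *-mono-≤ pivot (∏-map-mono xs u≤v) ⟩
  v x * d * product (map v xs) ≡⟨ xy∙z≈xz∙y (v x) d _ ⟩
  v x * product (map v xs) * d ∎
  where open ≤-Reasoning
∏-map-mono-pivot {u} {v} {c = c} {d} (y ∷ xs) (there x₀∈) u≤v pivot = begin
  u y * product (map u xs) * c   ≡⟨ *-assoc (u y) _ c ⟩
  u y * (product (map u xs) * c) ≤⟨ *-mono-≤ (u≤v y) (∏-map-mono-pivot xs x₀∈ u≤v pivot) ⟩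
  v y * (product (map v xs) * d) ≡⟨ *-assoc (v y) _ d ⟨
  v y * product (map v xs) * d   ∎
  where open ≤-Reasoning

module _ {P Q : Pred ℕ 0ℓ} (P? : Decidable P) (Q? : Decidable Q) (P⊆Q : P ⊆ Q)
         {f : ℕ → ℕ} (f≤id : ∀ x → f x ≤ x) where

  -- The cross-multiplied form of  ∏_Q f(x)/x ≤ (f x₀ / x₀) · ∏_P f(x)/x,
  -- which holds because every ratio f(x)/x is at most 1 and x₀ ∈ Q ∖ P.
  ∏-filter-ratio : ∀ {x₀} xs → x₀ ∈ xs → Q x₀ → ¬ P x₀ →
    product (map f (filter Q? xs)) * product (filter P? xs) * x₀
      ≤ product (map f (filter P? xs)) * product (filter Q? xs) * f x₀
  ∏-filter-ratio {x₀} xs x₀∈ Qx₀ ¬Px₀ = begin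
    product (map f (filter Q? xs)) * product (filter P? xs) * x₀ ≡⟨ cong (_* x₀) (∏-pair Q? P? xs) ⟩
    product (map u xs) * x₀                                      ≤⟨ ∏-map-mono-pivot xs x₀∈ u≤v pivot ⟩
    product (map v xs) * f x₀                                    ≡⟨ cong (_* f x₀) (∏-pair P? Q? xs) ⟨
    product (map f (filter P? xs)) * product (filter Q? xs) * f x₀ ∎
    where
    open ≤-Reasoning

    ∏-pair : ∀ {A B : Pred ℕ 0ℓ} (A? : Decidable A) (B? : Decidable B) xs →
      product (map f (filter A? xs)) * product (filter B? xs)
        ≡ product (map (λ x → restrict A? f x * restrict B? id x) xs)
    ∏-pair A? B? xs = trans
      (cong₂ _*_ (∏-map-filter A? f xs) (trans (cong product (sym (map-id (filter B? xs)))) (∏-map-filter B? id xs)))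
      (sym (∏-map-* (restrict A? f) (restrict B? id) xs))

    u v : ℕ → ℕ
    u x = restrict Q? f x * restrict P? id x
    v x = restrict P? f x * restrict Q? id x

    u≤v : ∀ x → u x ≤ v x
    u≤v x with P? x | Q? x
    ... | yes _  | yes _  = ≤-refl
    ... | yes Px | no ¬Qx = contradiction (P⊆Q Px) ¬Qx
    ... | no _   | yes _  = subst₂ _≤_ (sym (*-identityʳ (f x))) (sym (*-identityˡ x)) (f≤id x)
    ... | no _   | no _   = ≤-refl

    pivot : u x₀ * x₀ ≤ v x₀ * f x₀
    pivot with P? x₀ | Q? x₀
    ... | yes Px₀ | _      = contradiction Px₀ ¬Px₀
    ... | no _    | no ¬Qx₀ = contradiction Qx₀ ¬Qx₀
    ... | no _    | yes _   = ≤-reflexive (swap (f x₀) x₀)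
      where
      swap : ∀ a b → a * 1 * b ≡ 1 * b * a
      swap = solve-∀

∏∸-positive⁻ : ∀ r {x} xs → 0 < product (map (_∸ r) xs) → x ∈ xs → r < x
∏∸-positive⁻ r xs ∏>0 x∈ = m∸n≢0⇒n<m λ x∸r≡0 →
  <⇒≢ ∏>0 (sym (0∣⇒≡0 (subst (_∣ product (map (_∸ r) xs)) x∸r≡0 (∈⇒∣product (∈-map⁺ (_∸ r) x∈)))))

∏∸-positive⁺ : ∀ r xs → (∀ {x} → x ∈ xs → r < x) → 0 < product (map (_∸ r) xs)
∏∸-positive⁺ r xs above =
  >-nonZero⁻¹ _ {{product≢0 (map⁺ (All.tabulate (λ x∈ → >-nonZero (m<n⇒0<n∸m (above x∈)))))}}

PrimeDivisor : ℕ → Pred ℕ 0ℓ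
PrimeDivisor n p = Prime p × p ∣ n

primeDivisor? : ∀ n → Decidable (PrimeDivisor n)
primeDivisor? n p = prime? p ×-dec p ∣? n

primeDivisorsBelow : ℕ → ℕ → List ℕ
primeDivisorsBelow b n = filter (primeDivisor? n) (upTo b)

∈-primeDivisorsBelow⁻ : ∀ {b n p} → p ∈ primeDivisorsBelow b n → PrimeDivisor n p × p < b
∈-primeDivisorsBelow⁻ {b} {n} p∈ =
  let p∈upTo , pd = ∈-filter⁻ (primeDivisor? n) {xs = upTo b} p∈ in pd , ∈-upTo⁻ p∈upTo

∈-primeDivisors⁺ : ∀ {n p} .{{_ : NonZero n}} → PrimeDivisor n p → p ∈ primeDivisors n
∈-primeDivisors⁺ {n} pd@(_ , p∣n) = ∈-filter⁺ (primeDivisor? n) (∈-upTo⁺ (s≤s (∣⇒≤ p∣n))) pd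

primeDivisorsBelow-prime : ∀ b n → All Prime (primeDivisorsBelow b n)
primeDivisorsBelow-prime b n = All.tabulate (proj₁ ∘′ proj₁ ∘′ ∈-primeDivisorsBelow⁻ {b} {n})

primeDivisorsBelow-suc : ∀ b n →
  primeDivisorsBelow (suc b) n ≡ primeDivisorsBelow b n ++ filter (primeDivisor? n) [ b ]
primeDivisorsBelow-suc b n =
  trans (cong (filter (primeDivisor? n)) (sym (upTo-∷ʳ b))) (filter-++ (primeDivisor? n) (upTo b) [ b ])

primeDivisorsBelow-stable : ∀ {b n} .{{_ : NonZero n}} → n < b → primeDivisorsBelow b n ≡ primeDivisors n
primeDivisorsBelow-stable {n = n} n<b = stable (≤⇒≤′ n<b)
  where
  open ≡-Reasoning
  stable : ∀ {b} → n <′ b → primeDivisorsBelow b n ≡ primeDivisors n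
  stable ≤′-refl = refl
  stable {suc b} (≤′-step n<′b) = begin
    primeDivisorsBelow (suc b) n                             ≡⟨ primeDivisorsBelow-suc b n ⟩
    primeDivisorsBelow b n ++ filter (primeDivisor? n) [ b ] ≡⟨ cong (primeDivisorsBelow b n ++_) (filter-reject (primeDivisor? n) b∤n) ⟩
    primeDivisorsBelow b n ++ []                             ≡⟨ ++-identityʳ _ ⟩
    primeDivisorsBelow b n                                   ≡⟨ stable n<′b ⟩
    primeDivisors n                                          ∎
    where
    b∤n : ¬ PrimeDivisor n b
    b∤n (_ , b∣n) = <⇒≱ (≤′⇒≤ n<′b) (∣⇒≤ b∣n)

coprime-∏primeDivisorsBelow : ∀ {b} n → Prime b → Coprime b (product (primeDivisorsBelow b n))
coprime-∏primeDivisorsBelow {b} n pb {d} (d∣b , d∣∏) with prime⇒irreducible pb d∣b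
... | inj₁ d≡1 = d≡1
... | inj₂ refl = contradiction (proj₂ (∈-primeDivisorsBelow⁻ b∈)) (<-irrefl refl)
  where
  b∈ : b ∈ primeDivisorsBelow b n
  b∈ = factorisationHasAllPrimeFactors pb d∣∏ (primeDivisorsBelow-prime b n)

∏primeDivisorsBelow∣ : ∀ b n → product (primeDivisorsBelow b n) ∣ n
∏primeDivisorsBelow∣ zero    n = 1∣ n
∏primeDivisorsBelow∣ (suc b) n with primeDivisor? n b
... | no ¬pd = begin
  product (primeDivisorsBelow (suc b) n) ≡⟨ cong product (primeDivisorsBelow-suc b n) ⟩
  product (L ++ filter (primeDivisor? n) [ b ]) ≡⟨ cong (product ∘′ (L ++_)) (filter-reject (primeDivisor? n) ¬pd) ⟩
  product (L ++ [])                      ≡⟨ cong product (++-identityʳ L) ⟩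
  product L                              ∣⟨ ∏primeDivisorsBelow∣ b n ⟩
  n                                      ∎
  where
  open ∣-Reasoning
  L = primeDivisorsBelow b n
... | yes pd@(pb , b∣n) = begin
  product (primeDivisorsBelow (suc b) n) ≡⟨ cong product (primeDivisorsBelow-suc b n) ⟩
  product (L ++ filter (primeDivisor? n) [ b ]) ≡⟨ cong (product ∘′ (L ++_)) (filter-accept (primeDivisor? n) pd) ⟩
  product (L ++ [ b ])                   ≡⟨ product-++ L [ b ] ⟩
  product L * (b * 1)                    ≡⟨ cong (product L *_) (*-identityʳ b) ⟩
  product L * b                          ∣⟨ coprime-∣⇒*∣ (Coprime.sym (coprime-∏primeDivisorsBelow n pb)) (∏primeDivisorsBelow∣ b n) b∣n ⟩
  n                                      ∎
  where
  open ∣-Reasoning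
  L = primeDivisorsBelow b n

rad∣n : ∀ n → rad n ∣ n
rad∣n n = ∏primeDivisorsBelow∣ (suc n) n

rad≢0 : ∀ n → NonZero (rad n)
rad≢0 n = >-nonZero (productOfPrimes≥1 (primeDivisorsBelow-prime (suc n) n))

R*rad≡n : ∀ n → R n * rad n ≡ n
R*rad≡n n with rad n | rad∣n n | productOfPrimes≥1 (primeDivisorsBelow-prime (suc n) n)
... | suc _ | rad∣n | _ = m/n*n≡m rad∣n

shiftedRad : ℕ → ℕ → ℕ
shiftedRad r n = product (map (_∸ r) (primeDivisors n))

PrimeFactorsAbove : ℕ → ℕ → Set
PrimeFactorsAbove r n = ∀ {p} → Prime p → p ∣ n → r < p

inB⇒primeFactorsAbove : ∀ {r n} → InB r n → PrimeFactorsAbove r n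
inB⇒primeFactorsAbove {r} {n} (1≤n , S>0) pp p∣n =
  ∏∸-positive⁻ r (primeDivisors n) shiftedRad>0 (∈-primeDivisors⁺ {{>-nonZero 1≤n}} (pp , p∣n))
  where
  shiftedRad>0 : 0 < shiftedRad r n
  shiftedRad>0 = >-nonZero⁻¹ _ {{m*n≢0⇒n≢0 (R n) {{>-nonZero S>0}}}}

primeFactorsAbove⇒inB : ∀ {r n} → 1 ≤ n → PrimeFactorsAbove r n → InB r n
primeFactorsAbove⇒inB {r} {n} 1≤n above = 1≤n , >-nonZero⁻¹ _ {{m*n≢0 (R n) (shiftedRad r n)}}
  where
  instance
    R≢0 : NonZero (R n)
    R≢0 = m*n≢0⇒m≢0 (R n) {{subst NonZero (sym (R*rad≡n n)) (>-nonZero 1≤n)}}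
    shiftedRad≢0 : NonZero (shiftedRad r n)
    shiftedRad≢0 = >-nonZero (∏∸-positive⁺ r (primeDivisors n)
      (λ p∈ → let (pp , p∣n) , _ = ∈-primeDivisorsBelow⁻ {suc n} p∈ in above pp p∣n))

shiftedRad-ratio : ∀ r {n m q} .{{_ : NonZero n}} .{{_ : NonZero m}} →
  (∀ {p} → PrimeDivisor n p → p ∣ m) → Prime q → q ∣ m → ¬ q ∣ n →
  shiftedRad r m * rad n * q ≤ shiftedRad r n * rad m * (q ∸ r)
shiftedRad-ratio r {n} {m} {q} n⇒m pq q∣m q∤n = subst₂
  (λ A B → product (map (_∸ r) A) * product B * q ≤ product (map (_∸ r) B) * product A * (q ∸ r))
  (primeDivisorsBelow-stable (s≤s (m≤m⊔n m n)))
  (primeDivisorsBelow-stable (s≤s (m≤n⊔m m n)))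
  (∏-filter-ratio (primeDivisor? n) (primeDivisor? m) (λ pd@(pp , _) → pp , n⇒m pd) (λ x → m∸n≤m x r)
    (upTo (suc (m ⊔ n))) (∈-upTo⁺ (s≤s (≤-trans (∣⇒≤ q∣m) (m≤m⊔n m n)))) (pq , q∣m) (q∤n ∘′ proj₂))

coprime-primorial⇒primeFactorsAbove : ∀ {r k} → Coprime k (primorial r) → PrimeFactorsAbove r k
coprime-primorial⇒primeFactorsAbove {r} coprime {p} pp p∣k with r <? p
... | yes r<p = r<p
... | no  r≮p = contradiction (subst Prime (coprime (p∣k , p∣r#)) pp) ¬prime[1]
  where
  p∣r# : p ∣ primorial r
  p∣r# = ∈⇒∣product (∈-filter⁺ prime? (∈-upTo⁺ (s≤s (≮⇒≥ r≮p))) pp)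

-- The window starts at + suc a, and ∣ + suc a ℤ.+ + i ∣ reduces to suc a + i.
consecutiveProperty-window : ∀ {N J} → ConsecutiveProperty N J →
  ∀ a → ∃ λ k → a < k × k ≤ a + J × Coprime k N
consecutiveProperty-window {J = J} cp a with cp (+ suc a)
... | i , i<J , coprime =
  suc a + i , s≤s (m≤m+n a i) , subst (_≤ a + J) (+-suc a i) (+-monoʳ-≤ a i<J) , coprime

module _ {n q k : ℕ} .{{_ : NonZero n}} .{{_ : NonZero k}} (pq : Prime q) where

  private
    instance
      q≢0 = prime⇒nonZero pq
      rad[n]≢0 = rad≢0 n
      q*rad[n]≢0 = m*n≢0 q (rad n)
      m≢0 = m*n≢0 k (q * rad n)

  n<k*[q*rad[n]] : R n < k * q → n < k * (q * rad n)
  n<k*[q*rad[n]] R[n]<kq = begin-strict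
    n               ≡⟨ R*rad≡n n ⟨
    R n * rad n     <⟨ *-monoˡ-< (rad n) R[n]<kq ⟩
    k * q * rad n   ≡⟨ *-assoc k q (rad n) ⟩
    k * (q * rad n) ∎
    where open ≤-Reasoning

  k*[q*rad[n]]∈B : ∀ {r} → InB r n → r < q → PrimeFactorsAbove r k → InB r (k * (q * rad n))
  k*[q*rad[n]]∈B {r} n∈B r<q k-above = primeFactorsAbove⇒inB (>-nonZero⁻¹ _) above
    where
    above : PrimeFactorsAbove r (k * (q * rad n))
    above pp p∣m with euclidsLemma k (q * rad n) pp p∣m
    ... | inj₁ p∣k = k-above pp p∣k
    ... | inj₂ p∣q*rad with euclidsLemma q (rad n) pp p∣q*rad
    ...   | inj₁ p∣q   = subst (r <_) (sym (prime∣prime⇒≡ pp pq p∣q)) r<q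
    ...   | inj₂ p∣rad = inB⇒primeFactorsAbove n∈B pp (∣-trans p∣rad (rad∣n n))

  S[k*[q*rad[n]]]≤S[n] : ∀ {r} → ¬ q ∣ n → k * (q ∸ r) ≤ R n → S r (k * (q * rad n)) ≤ S r n
  S[k*[q*rad[n]]]≤S[n] {r} q∤n k[q∸r]≤R[n] = *-cancelʳ-≤ (S r m) (S r n) (rad m) {{rad≢0 m}} (begin
    R m * shiftedRad r m * rad m             ≡⟨ xy∙z≈xz∙y (R m) _ _ ⟩
    R m * rad m * shiftedRad r m             ≡⟨ cong (_* shiftedRad r m) (R*rad≡n m) ⟩
    k * (q * rad n) * shiftedRad r m         ≡⟨ regroup k q (rad n) (shiftedRad r m) ⟩
    k * (shiftedRad r m * rad n * q)         ≤⟨ *-monoʳ-≤ k (shiftedRad-ratio r n⇒m pq q∣m q∤n) ⟩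
    k * (shiftedRad r n * rad m * (q ∸ r))   ≡⟨ x∙yz≈xz∙y k _ (q ∸ r) ⟩
    k * (q ∸ r) * (shiftedRad r n * rad m)   ≤⟨ *-monoˡ-≤ _ k[q∸r]≤R[n] ⟩
    R n * (shiftedRad r n * rad m)           ≡⟨ *-assoc (R n) _ _ ⟨
    R n * shiftedRad r n * rad m             ∎)
    where
    open ≤-Reasoning
    m = k * (q * rad n)
    n⇒m : ∀ {p} → PrimeDivisor n p → p ∣ m
    n⇒m pd = ∣-trans (∈⇒∣product (∈-primeDivisors⁺ pd)) (∣n⇒∣m*n k (n∣m*n q))
    q∣m : q ∣ m
    q∣m = ∣n⇒∣m*n k (m∣m*n (rad n))
    regroup : ∀ k q d t → k * (q * d) * t ≡ k * (t * d * q)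
    regroup = solve-∀

inF⇒J*q*[q∸r]≰r*R : ∀ {r n q J} → InF r n → Prime q → r < q → ¬ q ∣ n →
  ConsecutiveProperty (primorial r) J → ¬ J * (q * (q ∸ r)) ≤ r * R n
inF⇒J*q*[q∸r]≰r*R {r} {n} {q} {J} (n∈B@(1≤n , _) , minimal) pq r<q q∤n cp J-small
  with consecutiveProperty-window cp ((R n / q) {{prime⇒nonZero pq}})
... | k , R[n]/q<k , k≤R[n]/q+J , coprime = <⇒≱ (minimal m m∈B n<m) S[m]≤S[n]
  where
  instance
    n≢0 = >-nonZero 1≤n
    k≢0 = >-nonZero (<-≤-trans z<s R[n]/q<k)
    q≢0 = prime⇒nonZero pq
  m = k * (q * rad n)
  n<m : n < m
  n<m = n<k*[q*rad[n]] pq (<-≤-trans (m<[1+m/n]*n (R n) q) (*-monoˡ-≤ q R[n]/q<k))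
  m∈B : InB r m
  m∈B = k*[q*rad[n]]∈B pq n∈B r<q (coprime-primorial⇒primeFactorsAbove coprime)
  S[m]≤S[n] : S r m ≤ S r n
  S[m]≤S[n] = S[k*[q*rad[n]]]≤S[n] pq {r} q∤n (k*[q∸r]≤x {R n / q} (<⇒≤ r<q) (m/n*n≤m (R n) q) k≤R[n]/q+J J-small)

lemma3p5 : (r : ℕ) → 1 ≤ r → (n : ℕ) → InF r n
         → (q J : ℕ) → IsQ1 r n q → IsJacobsthal (primorial r) J
         → r * R n < J * (q * (q ∸ r))
lemma3p5 r _ n n∈F q J ((pq , r<q , q∤n) , _) (_ , cp , _) =
  ≰⇒> (inF⇒J*q*[q∸r]≰r*R n∈F pq r<q q∤n cp)
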